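{- Let $a,b\in\mathbb{Z}$, $q\in\mathbb{Z}\setminus\{0\}$, $m$ a positive integer, and for integers $c,d$ let $w_n(c,d,q)$ denote the sequence with $w_0=c$, $w_1=d$, $w_n=qw_{n-1}+w_{n-2}$. Then $(w_n(a,b,q))$ modulo $m$ is residue complete if and only if all of the following hold: there is an integer $d$ such that the period of $(w_n(a,b,q))$ modulo $m$ equals, up to cyclic permutation, $d$ times the period of $(w_n(0,1,q))$ modulo $m$; $\gcd(a^2+qab-b^2,m)=1$; and $(w_n(0,1,q))$ modulo $m$ is residue complete. Moreover, if $(w_n(a,b,q))$ is residue complete modulo $m$, then it is residue complete modulo $r$ for every positive divisor $r$ of $m$.
   Context: A sequence $(x_n)$ is residue complete modulo $m$ if every residue class of $\mathbb{Z}_m$ occurs among the $x_n$ modulo $m$. The period of a sequence modulo $m$ is the cyclic list $(x_0,\dots,x_{k-1})$ modulo $m$ where $k$ is the least positive integer with $x_{n+k}\equiv x_n\pmod m$ for all $n$. -}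

module Defs where

open import Data.Nat as ℕ using (ℕ; zero; suc; NonZero)
open import Data.Integer using (ℤ; +_; _+_; _-_; _*_)
open import Data.Integer.Base using (_%ℕ_)
open import Data.Integer.Divisibility using (_∣_)
open import Data.List using (List; map; upTo; drop; take; _++_; length)
open import Data.Product using (Σ; ∃; _×_)
open import Relation.Binary.PropositionalEquality using (_≡_)

w : ℤ → ℤ → ℤ → ℕ → ℤ
w c d q zero = c
w c d q (suc zero) = d
w c d q (suc (suc n)) = q * w c d q (suc n) + w c d q n

_≡_[mod_] : ℤ → ℤ → ℕ → Set
x ≡ y [mod m ] = (+ m) ∣ (x - y)

ResidueComplete : ℕ → (ℕ → ℤ) → Set
ResidueComplete m x = (r : ℤ) → ∃ λ n → x n ≡ r [mod m ]

IsPeriodLength : ℕ → (ℕ → ℤ) → ℕ → Set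
IsPeriodLength m x k =
  (0 ℕ.< k) ×
  ((n : ℕ) → x (n ℕ.+ k) ≡ x n [mod m ]) ×
  ((j : ℕ) → 0 ℕ.< j → ((n : ℕ) → x (n ℕ.+ j) ≡ x n [mod m ]) → k ℕ.≤ j)

periodList : (m : ℕ) → .{{_ : NonZero m}} → (ℕ → ℤ) → ℕ → List ℕ
periodList m x k = map (λ n → x n %ℕ m) (upTo k)

rotate : {A : Set} → ℕ → List A → List A
rotate s L = drop s L ++ take s L

CyclicPerm : List ℕ → List ℕ → Set
CyclicPerm L L' = ∃ λ s → (s ℕ.< length L) × (rotate s L ≡ L')

scaleMod : (m : ℕ) → .{{_ : NonZero m}} → ℤ → List ℕ → List ℕ
scaleMod m d L = map (λ r → (d * + r) %ℕ m) L

-- Write G = w(a, b, q), F = w(0, 1, q) and E = w(1, 0, q). The addition formula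
-- G(n + s) = G(s) E(n) + G(s + 1) F(n) shows that once G(s) ≡ 0 (mod m), the tail of G
-- is d·F with d = G(s + 1). Residue completeness of G supplies such a zero, and since
-- the tail then also hits 1, d is invertible; conversely the cyclic-permutation condition
-- exhibits s and d directly. The form N(x, y) = x² + qxy − y² only changes sign along the
-- recurrence and N(0, d) = −d², so d is invertible mod m iff N(a, b) is, i.e. iff
-- gcd(a² + qab − b², m) = 1. Finally d·F with d invertible is residue complete iff F is,
-- and it has the same periods as F, which forces the two period lengths to agree.

module Submission where

open import Defs
open import Data.Nat as ℕ using (ℕ; NonZero)
open import Data.Integer using (ℤ; +_; _+_; _-_; _*_; 0ℤ; 1ℤ)
open import Data.Integer.GCD using (gcd)
open import Data.Nat.Divisibility using () renaming (_∣_ to _∣ℕ_)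
open import Data.Product using (∃; _×_)
open import Function.Bundles using (_⇔_)
open import Relation.Binary.PropositionalEquality using (_≡_; _≢_)

open import Data.Nat using (zero; suc; _≤_; _<_; _∸_; _%_; s≤s; z≤n; >-nonZero)
open import Data.Nat.Properties
  using (+-assoc; +-comm; +-identityʳ; m+[n∸m]≡n; m∸n+n≡m; ≤-antisym; ≤-<-trans; ⊔-lub; <⇒≤)
open import Data.Nat.DivMod using (m≡m%n+[m/n]*n; m%n<n; _/_)
open import Data.Nat.Divisibility using (>⇒∤; ∣1⇒≡1; ∣-trans)
open import Data.Nat.Coprimality using (Coprime; coprime⇒gcd≡1; gcd≡1⇒coprime; coprime-Bézout)
open import Data.Nat.GCD using (module Bézout)
open import Data.Nat.Tactic.RingSolver as ℕ-Solver using ()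
open import Data.Integer using (-_; ∣_∣)
open import Data.Integer.Base using (_%ℕ_; _/ℕ_)
open import Data.Integer.Properties
  using ( +-injective; ∣i∣≡0⇒i≡0; i-j≡0⇒i≡j; m-n≡m⊖n; ∣m⊝n∣≤m⊔n; neg-involutive
        ; pos-+; pos-*; *-comm; +∣i∣≡i⊎+∣i∣≡-i)
open import Data.Integer.DivMod using (a≡a%ℕn+[a/ℕn]*n; n%ℕd<d)
open import Data.Integer.Divisibility.Signed
  using (_∣_; divides; ∣ᵤ⇒∣; ∣⇒∣ᵤ; ∣m∣n⇒∣m+n; ∣m⇒∣-m; ∣m⇒∣m*n; ∣n⇒∣m*n; ∣m∣n⇒∣m-n)
  renaming (∣-trans to ∣ᵢ-trans)
open import Data.Integer.Tactic.RingSolver using (solve-∀)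
open import Data.List using (_∷_; applyUpTo; drop; take; _++_; length; map; upTo)
open import Data.List.Properties
  using (length-map; length-upTo; map-upTo; map-applyUpTo; length-applyUpTo; ∷-injectiveˡ; ∷-injectiveʳ)
open import Data.Product using (_,_; proj₁; proj₂)
open import Data.Sum using (_⊎_; inj₁; inj₂)
open import Function.Base using (_∘_)
open import Function.Bundles using (mk⇔; Equivalence)
open import Function.Construct.Identity using (⇔-id)
open import Function.Properties.Equivalence using (⇔-setoid)
open import Level using (0ℓ)
open import Relation.Binary.Bundles using (Setoid)
open import Relation.Binary.Structures using (IsEquivalence)
open import Relation.Binary.PropositionalEquality using (refl; cong; cong₂; subst; setoid; module ≡-Reasoning)
import Relation.Binary.PropositionalEquality as ≡
open import Relation.Nullary using (contradiction)

module PeriodicSequences {c ℓ} (S : Setoid c ℓ) where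
  open Setoid S

  Periodic : (ℕ → Carrier) → ℕ → Set ℓ
  Periodic x k = ∀ n → x (n ℕ.+ k) ≈ x n

  module _ {x : ℕ → Carrier} {k : ℕ} (per : Periodic x k) where

    periodic-+* : ∀ j n → x (n ℕ.+ j ℕ.* k) ≈ x n
    periodic-+* zero n = reflexive (cong x (+-identityʳ n))
    periodic-+* (suc j) n = trans (reflexive (cong x (reassoc n j k))) (trans (per _) (periodic-+* j n))
      where
      reassoc : ∀ n j k → n ℕ.+ (k ℕ.+ j ℕ.* k) ≡ n ℕ.+ j ℕ.* k ℕ.+ k
      reassoc = ℕ-Solver.solve-∀

    periodic-% : .{{_ : NonZero k}} → ∀ n → x (n % k) ≈ x n
    periodic-% n = sym (trans (reflexive (cong x (m≡m%n+[m/n]*n n k))) (periodic-+* (n / k) (n % k)))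

    periodic-shift : ∀ s → Periodic (λ n → x (n ℕ.+ s)) k
    periodic-shift s n = trans (reflexive (cong x (reorder n k s))) (per (n ℕ.+ s))
      where
      reorder : ∀ n k s → n ℕ.+ k ℕ.+ s ≡ n ℕ.+ s ℕ.+ k
      reorder = ℕ-Solver.solve-∀

    periodic-unshift : ∀ {s} → s ≤ k → ∀ n → x n ≈ x ((k ∸ s ℕ.+ n) ℕ.+ s)
    periodic-unshift {s} s≤k n = sym (trans (reflexive (cong x index)) (per n))
      where
      index : k ∸ s ℕ.+ n ℕ.+ s ≡ n ℕ.+ k
      index = ≡.trans (reorder (k ∸ s) n s) (cong (n ℕ.+_) (m∸n+n≡m s≤k))
        where
        reorder : ∀ i n s → i ℕ.+ n ℕ.+ s ≡ n ℕ.+ (i ℕ.+ s)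
        reorder = ℕ-Solver.solve-∀

    periodic-shift⁻ : ∀ {s j} → s ≤ k → Periodic (λ n → x (n ℕ.+ s)) j → Periodic x j
    periodic-shift⁻ {s} {j} s≤k perₛ n = begin
      x (n ℕ.+ j)                        ≈⟨ periodic-unshift s≤k (n ℕ.+ j) ⟩
      x (k ∸ s ℕ.+ (n ℕ.+ j) ℕ.+ s)      ≡⟨ cong (λ i → x (i ℕ.+ s)) (≡.sym (+-assoc (k ∸ s) n j)) ⟩
      x (k ∸ s ℕ.+ n ℕ.+ j ℕ.+ s)        ≈⟨ perₛ (k ∸ s ℕ.+ n) ⟩
      x (k ∸ s ℕ.+ n ℕ.+ s)              ≈⟨ periodic-unshift s≤k n ⟨
      x n                                ∎
      where open import Relation.Binary.Reasoning.Setoid S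

  periodic-resp : ∀ {x y k} → (∀ n → y n ≈ x n) → Periodic x k → Periodic y k
  periodic-resp y≈x per n = trans (y≈x _) (trans (per n) (sym (y≈x n)))

  periodic-agree : ∀ {x y k} .{{_ : NonZero k}} → Periodic x k → Periodic y k →
                   (∀ {i} → i < k → x i ≈ y i) → ∀ n → x n ≈ y n
  periodic-agree {k = k} perx pery agree n =
    trans (sym (periodic-% perx n)) (trans (agree (m%n<n n k)) (periodic-% pery n))

module _ {A : Set} where
  open PeriodicSequences (setoid A) using (Periodic)

  drop-applyUpTo : ∀ (f : ℕ → A) s k → drop s (applyUpTo f k) ≡ applyUpTo (λ i → f (s ℕ.+ i)) (k ∸ s)
  drop-applyUpTo f zero    k       = refl
  drop-applyUpTo f (suc s) zero    = refl
  drop-applyUpTo f (suc s) (suc k) = drop-applyUpTo (f ∘ suc) s k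

  take-applyUpTo : ∀ (f : ℕ → A) {s k} → s ≤ k → take s (applyUpTo f k) ≡ applyUpTo f s
  take-applyUpTo f z≤n       = refl
  take-applyUpTo f (s≤s s≤k) = cong (f 0 ∷_) (take-applyUpTo (f ∘ suc) s≤k)

  applyUpTo-++ : ∀ (f : ℕ → A) i j → applyUpTo f (i ℕ.+ j) ≡ applyUpTo f i ++ applyUpTo (λ n → f (i ℕ.+ n)) j
  applyUpTo-++ f zero    j = refl
  applyUpTo-++ f (suc i) j = cong (f 0 ∷_) (applyUpTo-++ (f ∘ suc) i j)

  applyUpTo-cong : ∀ {f g : ℕ → A} k → (∀ i → f i ≡ g i) → applyUpTo f k ≡ applyUpTo g k
  applyUpTo-cong zero    f≗g = refl
  applyUpTo-cong (suc k) f≗g = cong₂ _∷_ (f≗g 0) (applyUpTo-cong k (f≗g ∘ suc))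

  applyUpTo-injective : ∀ {f g : ℕ → A} k → applyUpTo f k ≡ applyUpTo g k → ∀ {i} → i < k → f i ≡ g i
  applyUpTo-injective (suc k) eq {zero}  _         = ∷-injectiveˡ eq
  applyUpTo-injective (suc k) eq {suc i} (s≤s i<k) = applyUpTo-injective k (∷-injectiveʳ eq) i<k

  rotate-applyUpTo : ∀ {f : ℕ → A} {k s} → Periodic f k → s ≤ k →
                     rotate s (applyUpTo f k) ≡ applyUpTo (λ i → f (s ℕ.+ i)) k
  rotate-applyUpTo {f} {k} {s} per s≤k = begin
    drop s (applyUpTo f k) ++ take s (applyUpTo f k)
      ≡⟨ cong₂ _++_ (drop-applyUpTo f s k) (take-applyUpTo f s≤k) ⟩
    applyUpTo fₛ (k ∸ s) ++ applyUpTo f s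
      ≡⟨ cong (applyUpTo fₛ (k ∸ s) ++_) (applyUpTo-cong s wrap) ⟩
    applyUpTo fₛ (k ∸ s) ++ applyUpTo (λ i → fₛ (k ∸ s ℕ.+ i)) s
      ≡⟨ applyUpTo-++ fₛ (k ∸ s) s ⟨
    applyUpTo fₛ (k ∸ s ℕ.+ s)
      ≡⟨ cong (applyUpTo fₛ) (m∸n+n≡m s≤k) ⟩
    applyUpTo fₛ k ∎
    where
    open ≡-Reasoning
    fₛ : ℕ → A
    fₛ i = f (s ℕ.+ i)
    wrap : ∀ i → f i ≡ fₛ (k ∸ s ℕ.+ i)
    wrap i = ≡.sym (begin
      f (s ℕ.+ (k ∸ s ℕ.+ i))  ≡⟨ cong f (+-assoc s (k ∸ s) i) ⟨
      f (s ℕ.+ (k ∸ s) ℕ.+ i)  ≡⟨ cong (λ j → f (j ℕ.+ i)) (m+[n∸m]≡n s≤k) ⟩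
      f (k ℕ.+ i)              ≡⟨ cong f (+-comm k i) ⟩
      f (i ℕ.+ k)              ≡⟨ per i ⟩
      f i                      ∎)

w-+ : ∀ c d q n s → w c d q (n ℕ.+ s) ≡ w c d q s * w 1ℤ 0ℤ q n + w c d q (suc s) * w 0ℤ 1ℤ q n
w-+ c d q zero          s = unit₀ (w c d q s) (w c d q (suc s))
  where
  unit₀ : ∀ x y → x ≡ x * 1ℤ + y * 0ℤ
  unit₀ = solve-∀
w-+ c d q (suc zero)    s = unit₁ (w c d q s) (w c d q (suc s))
  where
  unit₁ : ∀ x y → y ≡ x * 0ℤ + y * 1ℤ
  unit₁ = solve-∀
w-+ c d q (suc (suc n)) s = begin
  q * w c d q (suc n ℕ.+ s) + w c d q (n ℕ.+ s)
    ≡⟨ cong₂ (λ u v → q * u + v) (w-+ c d q (suc n) s) (w-+ c d q n s) ⟩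
  q * (x * e₁ + y * f₁) + (x * e₀ + y * f₀)
    ≡⟨ regroup q x y e₁ e₀ f₁ f₀ ⟩
  x * (q * e₁ + e₀) + y * (q * f₁ + f₀) ∎
  where
  open ≡-Reasoning
  x y e₁ e₀ f₁ f₀ : ℤ
  x = w c d q s
  y = w c d q (suc s)
  e₁ = w 1ℤ 0ℤ q (suc n)
  e₀ = w 1ℤ 0ℤ q n
  f₁ = w 0ℤ 1ℤ q (suc n)
  f₀ = w 0ℤ 1ℤ q n
  regroup : ∀ q x y e₁ e₀ f₁ f₀ →
            q * (x * e₁ + y * f₁) + (x * e₀ + y * f₀) ≡ x * (q * e₁ + e₀) + y * (q * f₁ + f₀)
  regroup = solve-∀

norm : ℤ → ℤ → ℤ → ℤ
norm q x y = x * x + q * x * y - y * y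

norm-step : ∀ q x y → norm q y (q * y + x) ≡ - norm q x y
norm-step = expanded
  where
  expanded : ∀ q x y → y * y + q * y * (q * y + x) - (q * y + x) * (q * y + x)
                       ≡ - (x * x + q * x * y - y * y)
  expanded = solve-∀

norm-w : ∀ c d q n → norm q (w c d q n) (w c d q (suc n)) ≡ norm q c d
                   ⊎ norm q (w c d q n) (w c d q (suc n)) ≡ - norm q c d
norm-w c d q zero = inj₁ refl
norm-w c d q (suc n) with norm-w c d q n
... | inj₁ eq = inj₂ (≡.trans (norm-step q (w c d q n) (w c d q (suc n))) (cong -_ eq))
... | inj₂ eq = inj₁ (≡.trans (norm-step q (w c d q n) (w c d q (suc n))) (≡.trans (cong -_ eq) (neg-involutive _)))

pos-+-* : ∀ i j k → + (i ℕ.+ j ℕ.* k) ≡ + i + + j * + k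
pos-+-* i j k = ≡.trans (pos-+ i (j ℕ.* k)) (cong (_+_ (+ i)) (pos-* j k))

module Congruence (m : ℕ) where

  -- A record, so that x and y can be inferred from a proof of x ≋ y.
  infix 4 _≋_
  record _≋_ (x y : ℤ) : Set where
    constructor ≋-intro
    field ≋-divides : + m ∣ x - y
  open _≋_

  private
    variable
      x y u v d e : ℤ

    ∣-resp : ∀ {i j} → i ≡ j → + m ∣ i → + m ∣ j
    ∣-resp = subst (+ m ∣_)

  ≡[mod]⇒≋ : x ≡ y [mod m ] → x ≋ y
  ≡[mod]⇒≋ p = ≋-intro (∣ᵤ⇒∣ p)

  ≋⇒≡[mod] : x ≋ y → x ≡ y [mod m ]
  ≋⇒≡[mod] p = ∣⇒∣ᵤ (≋-divides p)

  ≋-refl : x ≋ x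
  ≋-refl {x} = ≋-intro (divides 0ℤ (x-x≡0*m x (+ m)))
    where
    x-x≡0*m : ∀ x m → x - x ≡ 0ℤ * m
    x-x≡0*m = solve-∀

  ≋-reflexive : x ≡ y → x ≋ y
  ≋-reflexive refl = ≋-refl

  ≋-sym : x ≋ y → y ≋ x
  ≋-sym {x} {y} p = ≋-intro (∣-resp (neg-diff x y) (∣m⇒∣-m (≋-divides p)))
    where
    neg-diff : ∀ x y → - (x - y) ≡ y - x
    neg-diff = solve-∀

  ≋-trans : x ≋ y → y ≋ u → x ≋ u
  ≋-trans {x} {y} {u} p r = ≋-intro (∣-resp (telescope x y u) (∣m∣n⇒∣m+n (≋-divides p) (≋-divides r)))
    where
    telescope : ∀ x y u → (x - y) + (y - u) ≡ x - u
    telescope = solve-∀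

  ≋-isEquivalence : IsEquivalence _≋_
  ≋-isEquivalence = record { refl = ≋-refl ; sym = ≋-sym ; trans = ≋-trans }

  ≋-setoid : Setoid 0ℓ 0ℓ
  ≋-setoid = record { isEquivalence = ≋-isEquivalence }

  +-cong : x ≋ y → u ≋ v → x + u ≋ y + v
  +-cong {x} {y} {u} {v} p r = ≋-intro (∣-resp (diff-+ x y u v) (∣m∣n⇒∣m+n (≋-divides p) (≋-divides r)))
    where
    diff-+ : ∀ x y u v → (x - y) + (u - v) ≡ (x + u) - (y + v)
    diff-+ = solve-∀

  *-cong : x ≋ y → u ≋ v → x * u ≋ y * v
  *-cong {x} {y} {u} {v} p r =
    ≋-intro (∣-resp (diff-* x y u v) (∣m∣n⇒∣m+n (∣m⇒∣m*n u (≋-divides p)) (∣n⇒∣m*n y (≋-divides r))))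
    where
    diff-* : ∀ x y u v → (x - y) * u + y * (u - v) ≡ x * u - y * v
    diff-* = solve-∀

  -‿cong : x ≋ y → - x ≋ - y
  -‿cong {x} {y} p = ≋-intro (∣-resp (diff-neg x y) (∣m⇒∣-m (≋-divides p)))
    where
    diff-neg : ∀ x y → - (x - y) ≡ (- x) - (- y)
    diff-neg = solve-∀

  record Invertible (x : ℤ) : Set where
    constructor invertible
    field
      inverse   : ℤ
      inverse-≋ : x * inverse ≋ 1ℤ

  invertible-resp : x ≋ y → Invertible x → Invertible y
  invertible-resp x≋y (invertible e xe≋1) = invertible e (≋-trans (*-cong (≋-sym x≋y) ≋-refl) xe≋1)

  invertible-resp⇔ : x ≋ y → Invertible x ⇔ Invertible y
  invertible-resp⇔ x≋y = mk⇔ (invertible-resp x≋y) (invertible-resp (≋-sym x≋y))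

  *-inverse-cancel : ∀ {d e x} → d * e ≋ 1ℤ → d * (e * x) ≋ x
  *-inverse-cancel {d} {e} {x} de≋1 =
    ≋-trans (≋-reflexive (reassoc d e x)) (≋-trans (*-cong de≋1 ≋-refl) (≋-reflexive (one-* x)))
    where
    reassoc : ∀ d e x → d * (e * x) ≡ (d * e) * x
    reassoc = solve-∀
    one-* : ∀ x → 1ℤ * x ≡ x
    one-* = solve-∀

  inverse-*-cancel : (inv : Invertible d) → Invertible.inverse inv * (d * x) ≋ x
  inverse-*-cancel {d} {x} (invertible e de≋1) =
    *-inverse-cancel {e} {d} {x} (≋-trans (≋-reflexive (*-comm e d)) de≋1)

  *-cancelˡ : Invertible d → d * x ≋ d * y → x ≋ y
  *-cancelˡ {d} {x} {y} inv dx≋dy = begin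
    x              ≈⟨ inverse-*-cancel {x = x} inv ⟨
    d⁻¹ * (d * x)  ≈⟨ *-cong (≋-refl {d⁻¹}) dx≋dy ⟩
    d⁻¹ * (d * y)  ≈⟨ inverse-*-cancel {x = y} inv ⟩
    y              ∎
    where
    open import Relation.Binary.Reasoning.Setoid ≋-setoid
    d⁻¹ : ℤ
    d⁻¹ = Invertible.inverse inv

  +-multiple-≋ : ∀ x k → x + k * + m ≋ x
  +-multiple-≋ x k = ≋-intro (divides k (cancel x k (+ m)))
    where
    cancel : ∀ x k m → x + k * m - x ≡ k * m
    cancel = solve-∀

  invertible-neg : Invertible x → Invertible (- x)
  invertible-neg {x} (invertible e xe≋1) = invertible (- e) (≋-trans (≋-reflexive (neg-*-neg x e)) xe≋1)
    where
    neg-*-neg : ∀ x e → (- x) * (- e) ≡ x * e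
    neg-*-neg = solve-∀

  invertible-neg⇔ : Invertible (- x) ⇔ Invertible x
  invertible-neg⇔ {x} = mk⇔ (subst Invertible (neg-involutive x) ∘ invertible-neg) invertible-neg

  invertible-square⇔ : Invertible (x * x) ⇔ Invertible x
  invertible-square⇔ {x} = mk⇔ root square
    where
    root : Invertible (x * x) → Invertible x
    root (invertible e xxe≋1) = invertible (x * e) (≋-trans (≋-reflexive (reassoc x e)) xxe≋1)
      where
      reassoc : ∀ x e → x * (x * e) ≡ x * x * e
      reassoc = solve-∀
    square : Invertible x → Invertible (x * x)
    square (invertible e xe≋1) = invertible (e * e) (≋-trans (≋-reflexive (regroup x e)) (*-cong xe≋1 xe≋1))
      where
      regroup : ∀ x e → x * x * (e * e) ≡ (x * e) * (x * e)
      regroup = solve-∀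

  invertible⇒gcd≡1 : Invertible x → gcd x (+ m) ≡ 1ℤ
  invertible⇒gcd≡1 {x} (invertible e xe≋1) = cong +_ (coprime⇒gcd≡1 coprime)
    where
    coprime : Coprime ∣ x ∣ m
    coprime {c} (c∣x , c∣m) = ∣1⇒≡1 (∣⇒∣ᵤ c∣1)
      where
      cancel : ∀ y → y - (y - 1ℤ) ≡ 1ℤ
      cancel = solve-∀
      c∣1 : + c ∣ 1ℤ
      c∣1 = subst (+ c ∣_) (cancel (x * e))
              (∣m∣n⇒∣m-n (∣m⇒∣m*n e (∣ᵤ⇒∣ {i = x} c∣x)) (∣ᵢ-trans (∣ᵤ⇒∣ c∣m) (≋-divides xe≋1)))

  invertible-abs : Invertible (+ ∣ x ∣) → Invertible x
  invertible-abs {x} inv with +∣i∣≡i⊎+∣i∣≡-i x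
  ... | inj₁ eq = subst Invertible eq inv
  ... | inj₂ eq = Equivalence.to invertible-neg⇔ (subst Invertible eq inv)

  bézout⇒invertible : ∀ {n} → Bézout.Identity 1 n m → Invertible (+ n)
  bézout⇒invertible {n} (Bézout.+- u v eq) = invertible (+ u) (begin
    + n * + u          ≡⟨ *-comm (+ n) (+ u) ⟩
    + u * + n          ≡⟨ pos-* u n ⟨
    + (u ℕ.* n)        ≡⟨ cong +_ eq ⟨
    + (1 ℕ.+ v ℕ.* m)  ≡⟨ pos-+-* 1 v m ⟩
    1ℤ + + v * + m     ≈⟨ +-multiple-≋ 1ℤ (+ v) ⟩
    1ℤ                 ∎)
    where open import Relation.Binary.Reasoning.Setoid ≋-setoid
  bézout⇒invertible {n} (Bézout.-+ u v eq) = invertible (- + u) (begin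
    + n * - + u                ≡⟨ negate (+ n) (+ u) ⟩
    1ℤ - (1ℤ + + u * + n)      ≡⟨ cong (_-_ 1ℤ) (≡.trans (≡.sym (pos-+-* 1 u n)) (cong +_ eq)) ⟩
    1ℤ - + (v ℕ.* m)           ≡⟨ cong (_-_ 1ℤ) (pos-* v m) ⟩
    1ℤ - + v * + m             ≡⟨ to-multiple (+ v) (+ m) ⟩
    1ℤ + (- + v) * + m         ≈⟨ +-multiple-≋ 1ℤ (- + v) ⟩
    1ℤ                         ∎)
    where
    open import Relation.Binary.Reasoning.Setoid ≋-setoid
    negate : ∀ n u → n * - u ≡ 1ℤ - (1ℤ + u * n)
    negate = solve-∀
    to-multiple : ∀ v m → 1ℤ - v * m ≡ 1ℤ + (- v) * m
    to-multiple = solve-∀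

  gcd≡1⇒invertible : gcd x (+ m) ≡ 1ℤ → Invertible x
  gcd≡1⇒invertible {x} gcd≡1 =
    invertible-abs (bézout⇒invertible {∣ x ∣} (coprime-Bézout (gcd≡1⇒coprime (+-injective gcd≡1))))

  invertible⇔gcd≡1 : Invertible x ⇔ gcd x (+ m) ≡ 1ℤ
  invertible⇔gcd≡1 = mk⇔ invertible⇒gcd≡1 gcd≡1⇒invertible

  module _ .{{_ : NonZero m}} where

    ≋-%ℕ : ∀ x → x ≋ + (x %ℕ m)
    ≋-%ℕ x = ≋-trans (≋-reflexive (a≡a%ℕn+[a/ℕn]*n x m)) (+-multiple-≋ (+ (x %ℕ m)) (x /ℕ m))

    residue-unique : ∀ {i j} → i < m → j < m → + i ≋ + j → i ≡ j
    residue-unique {i} {j} i<m j<m i≋j =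
      +-injective (i-j≡0⇒i≡j (+ i) (+ j) (∣i∣≡0⇒i≡0 (multiple-below-m (≋⇒≡[mod] i≋j) distance<m)))
      where
      multiple-below-m : ∀ {k} → m ∣ℕ k → k < m → k ≡ 0
      multiple-below-m {zero}  _   _   = refl
      multiple-below-m {suc k} m∣k k<m = contradiction m∣k (>⇒∤ k<m)
      distance<m : ∣ + i - + j ∣ < m
      distance<m = subst (_< m) (cong ∣_∣ (≡.sym (m-n≡m⊖n i j))) (≤-<-trans (∣m⊝n∣≤m⊔n i j) (⊔-lub i<m j<m))

    %ℕ-cong : x ≋ y → x %ℕ m ≡ y %ℕ m
    %ℕ-cong {x} {y} x≋y =
      residue-unique (n%ℕd<d x m) (n%ℕd<d y m) (≋-trans (≋-sym (≋-%ℕ x)) (≋-trans x≋y (≋-%ℕ y)))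

    %ℕ-injective : x %ℕ m ≡ y %ℕ m → x ≋ y
    %ℕ-injective {x} {y} eq = ≋-trans (≋-%ℕ x) (≋-trans (≋-reflexive (cong +_ eq)) (≋-sym (≋-%ℕ y)))

residueComplete-∣ : ∀ {m r x} → r ∣ℕ m → ResidueComplete m x → ResidueComplete r x
residueComplete-∣ r∣m rc y = proj₁ (rc y) , ∣-trans r∣m (proj₂ (rc y))

module SequencesModulo (m : ℕ) where
  open Congruence m
  open PeriodicSequences ≋-setoid public

  private
    variable
      x y : ℕ → ℤ
      d : ℤ
      k l s : ℕ

  isPeriodLength⇒periodic : IsPeriodLength m x k → Periodic x k
  isPeriodLength⇒periodic (_ , per , _) n = ≡[mod]⇒≋ (per n)

  periodLength-unique : IsPeriodLength m x k → IsPeriodLength m y l → Periodic x l → Periodic y k → k ≡ l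
  periodLength-unique (k>0 , _ , minimal-x) (l>0 , _ , minimal-y) perx-l pery-k =
    ≤-antisym (minimal-x _ l>0 (≋⇒≡[mod] ∘ perx-l)) (minimal-y _ k>0 (≋⇒≡[mod] ∘ pery-k))

  periodic-*ˡ : Periodic x k → Periodic (λ n → d * x n) k
  periodic-*ˡ {d = d} per n = *-cong (≋-refl {d}) (per n)

  scaled-inverse : (inv : Invertible d) → (∀ n → y n ≋ d * x n) → ∀ n → x n ≋ Invertible.inverse inv * y n
  scaled-inverse {d} {y} {x} inv y≋dx n =
    ≋-trans (≋-sym (inverse-*-cancel {x = x n} inv)) (*-cong (≋-refl {Invertible.inverse inv}) (≋-sym (y≋dx n)))

  residueComplete-scaled⇔ : (∀ n → y n ≋ d * x n) → ResidueComplete m y ⇔ (Invertible d × ResidueComplete m x)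
  residueComplete-scaled⇔ {y} {d} {x} y≋dx = mk⇔ to from
    where
    to : ResidueComplete m y → Invertible d × ResidueComplete m x
    to rc = d-inv , rcx
      where
      hit : ∀ r → y (proj₁ (rc r)) ≋ r
      hit r = ≡[mod]⇒≋ (proj₂ (rc r))
      d-inv : Invertible d
      d-inv = invertible (x (proj₁ (rc 1ℤ))) (≋-trans (≋-sym (y≋dx _)) (hit 1ℤ))
      rcx : ResidueComplete m x
      rcx r = proj₁ (rc (d * r)) , ≋⇒≡[mod] (*-cancelˡ d-inv (≋-trans (≋-sym (y≋dx _)) (hit (d * r))))
    from : Invertible d × ResidueComplete m x → ResidueComplete m y
    from (invertible e de≋1 , rcx) r = n , ≋⇒≡[mod] (begin
      y n          ≈⟨ y≋dx n ⟩
      d * x n      ≈⟨ *-cong (≋-refl {d}) (≡[mod]⇒≋ (proj₂ (rcx (e * r)))) ⟩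
      d * (e * r)  ≈⟨ *-inverse-cancel {d} {e} {r} de≋1 ⟩
      r            ∎)
      where
      open import Relation.Binary.Reasoning.Setoid ≋-setoid
      n : ℕ
      n = proj₁ (rcx (e * r))

  residueComplete-shift⇔ : Periodic x k → s ≤ k → ResidueComplete m x ⇔ ResidueComplete m (λ n → x (n ℕ.+ s))
  residueComplete-shift⇔ {x} {k} {s} per s≤k = mk⇔ to from
    where
    to : ResidueComplete m x → ResidueComplete m (λ n → x (n ℕ.+ s))
    to rc r = k ∸ s ℕ.+ n , ≋⇒≡[mod] (≋-trans (≋-sym (periodic-unshift per s≤k n)) (≡[mod]⇒≋ x-n≡r))
      where
      n : ℕ
      n = proj₁ (rc r)
      x-n≡r : x n ≡ r [mod m ]
      x-n≡r = proj₂ (rc r)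
    from : ResidueComplete m (λ n → x (n ℕ.+ s)) → ResidueComplete m x
    from rc r = proj₁ (rc r) ℕ.+ s , proj₂ (rc r)

  module _ .{{_ : NonZero m}} where

    length-periodList : ∀ x k → length (periodList m x k) ≡ k
    length-periodList x k = ≡.trans (length-map _ (upTo k)) (length-upTo k)

    rotate-periodList : Periodic x k → s ≤ k → rotate s (periodList m x k) ≡ applyUpTo (λ n → x (n ℕ.+ s) %ℕ m) k
    rotate-periodList {x} {k} {s} per s≤k = begin
      rotate s (map residue (upTo k))            ≡⟨ cong (rotate s) (map-upTo residue k) ⟩
      rotate s (applyUpTo residue k)             ≡⟨ rotate-applyUpTo (λ n → %ℕ-cong (per n)) s≤k ⟩
      applyUpTo (λ n → residue (s ℕ.+ n)) k      ≡⟨ applyUpTo-cong k (λ n → cong residue (+-comm s n)) ⟩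
      applyUpTo (λ n → residue (n ℕ.+ s)) k      ∎
      where
      open ≡-Reasoning
      residue : ℕ → ℕ
      residue n = x n %ℕ m

    scaleMod-periodList : ∀ d x k → scaleMod m d (periodList m x k) ≡ applyUpTo (λ n → (d * x n) %ℕ m) k
    scaleMod-periodList d x k = begin
      map scale (map residue (upTo k))           ≡⟨ cong (map scale) (map-upTo residue k) ⟩
      map scale (applyUpTo residue k)            ≡⟨ map-applyUpTo residue scale k ⟩
      applyUpTo (scale ∘ residue) k              ≡⟨ applyUpTo-cong k (λ n → %ℕ-cong (*-cong (≋-refl {d}) (≋-%ℕ (x n)))) ⟨
      applyUpTo (λ n → (d * x n) %ℕ m) k         ∎
      where
      open ≡-Reasoning
      residue : ℕ → ℕ
      residue n = x n %ℕ m
      scale : ℕ → ℕ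
      scale r = (d * + r) %ℕ m

module RecurrenceModulo (m : ℕ) where
  open Congruence m

  norm-cong : ∀ q {x x′ y y′} → x ≋ x′ → y ≋ y′ → norm q x y ≋ norm q x′ y′
  norm-cong q x≋x′ y≋y′ = +-cong (+-cong (*-cong x≋x′ x≋x′) (*-cong (*-cong (≋-refl {q}) x≋x′) y≋y′))
                                 (-‿cong (*-cong y≋y′ y≋y′))

  tail-≋ : ∀ c d q {s} → w c d q s ≋ 0ℤ → ∀ n → w c d q (n ℕ.+ s) ≋ w c d q (suc s) * w 0ℤ 1ℤ q n
  tail-≋ c d q {s} zero-at-s n =
    ≋-trans (≋-reflexive (w-+ c d q n s))
    (≋-trans (+-cong (*-cong zero-at-s (≋-refl {w 1ℤ 0ℤ q n})) (≋-refl {w c d q (suc s) * w 0ℤ 1ℤ q n}))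
             (≋-reflexive (zero-*-+ (w 1ℤ 0ℤ q n) (w c d q (suc s) * w 0ℤ 1ℤ q n))))
    where
    zero-*-+ : ∀ x y → 0ℤ * x + y ≡ y
    zero-*-+ = solve-∀

  invertible⇔norm : ∀ {a b q s} {d} → (∀ n → w a b q (n ℕ.+ s) ≋ d * w 0ℤ 1ℤ q n) →
                    Invertible d ⇔ Invertible (norm q a b)
  invertible⇔norm {a} {b} {q} {s} {d} tail = begin
    Invertible d                         ≈⟨ invertible-square⇔ ⟨
    Invertible (d * d)                   ≈⟨ invertible-neg⇔ ⟨
    Invertible (- (d * d))               ≈⟨ invertible-resp⇔ (≋-trans (≋-reflexive (norm-at-zero q d))
                                              (norm-cong q (≋-sym (tail 0)) (≋-sym (tail 1)))) ⟩
    Invertible (norm q (w a b q s) (w a b q (suc s)))  ≈⟨ invariant (norm-w a b q s) ⟩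
    Invertible (norm q a b)              ∎
    where
    open import Relation.Binary.Reasoning.Setoid (⇔-setoid 0ℓ)
    norm-at-zero : ∀ q d → - (d * d) ≡ d * 0ℤ * (d * 0ℤ) + q * (d * 0ℤ) * (d * 1ℤ) - d * 1ℤ * (d * 1ℤ)
    norm-at-zero = solve-∀
    invariant : ∀ {x} → x ≡ norm q a b ⊎ x ≡ - norm q a b → Invertible x ⇔ Invertible (norm q a b)
    invariant (inj₁ refl) = ⇔-id _
    invariant (inj₂ refl) = invertible-neg⇔

module Criterion (a b q : ℤ) (m : ℕ) .{{_ : NonZero m}} where
  open Congruence m
  open SequencesModulo m
  open RecurrenceModulo m

  G F : ℕ → ℤ
  G = w a b q
  F = w 0ℤ 1ℤ q

  Conditions : ℕ → ℕ → Set
  Conditions kA kF =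
    (∃ λ (d : ℤ) → CyclicPerm (periodList m G kA) (scaleMod m d (periodList m F kF)))
    × (gcd (norm q a b) (+ m) ≡ 1ℤ)
    × ResidueComplete m F

  residueComplete⇒conditions : ∀ {kA kF} → IsPeriodLength m G kA → IsPeriodLength m F kF →
                               ResidueComplete m G → Conditions kA kF
  residueComplete⇒conditions {kA} {kF} isPeriodG@(kA>0 , _) isPeriodF rcG =
    (d , s , s<length , cyclic) , gcd≡1 , rcF
    where
    instance
      kA≢0 : NonZero kA
      kA≢0 = >-nonZero kA>0
    perG : Periodic G kA
    perG = isPeriodLength⇒periodic isPeriodG
    perF : Periodic F kF
    perF = isPeriodLength⇒periodic isPeriodF
    zero-index : ℕ
    zero-index = proj₁ (rcG 0ℤ)
    s : ℕ
    s = zero-index % kA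
    s≤kA : s ≤ kA
    s≤kA = <⇒≤ (m%n<n zero-index kA)
    d : ℤ
    d = G (suc s)
    tail : ∀ n → G (n ℕ.+ s) ≋ d * F n
    tail = tail-≋ a b q (≋-trans (periodic-% perG zero-index) (≡[mod]⇒≋ (proj₂ (rcG 0ℤ))))
    d-inv×rcF : Invertible d × ResidueComplete m F
    d-inv×rcF = Equivalence.to (residueComplete-scaled⇔ {d = d} {x = F} tail)
                  (Equivalence.to (residueComplete-shift⇔ perG s≤kA) rcG)
    d-inv : Invertible d
    d-inv = proj₁ d-inv×rcF
    rcF : ResidueComplete m F
    rcF = proj₂ d-inv×rcF
    gcd≡1 : gcd (norm q a b) (+ m) ≡ 1ℤ
    gcd≡1 = Equivalence.to invertible⇔gcd≡1 (Equivalence.to (invertible⇔norm tail) d-inv)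
    kA≡kF : kA ≡ kF
    kA≡kF = periodLength-unique isPeriodG isPeriodF
      (periodic-shift⁻ perG s≤kA (periodic-resp tail (periodic-*ˡ {d = d} perF)))
      (periodic-resp (scaled-inverse {x = F} d-inv tail)
                     (periodic-*ˡ {d = Invertible.inverse d-inv} (periodic-shift perG s)))
    s<length : s ℕ.< length (periodList m G kA)
    s<length = subst (s ℕ.<_) (≡.sym (length-periodList G kA)) (m%n<n zero-index kA)
    cyclic : rotate s (periodList m G kA) ≡ scaleMod m d (periodList m F kF)
    cyclic = begin
      rotate s (periodList m G kA)                ≡⟨ rotate-periodList perG s≤kA ⟩
      applyUpTo (λ n → G (n ℕ.+ s) %ℕ m) kA      ≡⟨ applyUpTo-cong kA (λ n → %ℕ-cong (tail n)) ⟩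
      applyUpTo (λ n → (d * F n) %ℕ m) kA        ≡⟨ cong (applyUpTo _) kA≡kF ⟩
      applyUpTo (λ n → (d * F n) %ℕ m) kF        ≡⟨ scaleMod-periodList d F kF ⟨
      scaleMod m d (periodList m F kF)            ∎
      where open ≡-Reasoning

  conditions⇒residueComplete : ∀ {kA kF} → IsPeriodLength m G kA → IsPeriodLength m F kF →
                               Conditions kA kF → ResidueComplete m G
  conditions⇒residueComplete {kA} {kF} isPeriodG isPeriodF@(kF>0 , _) ((d , s , s<length , cyclic) , gcd≡1 , rcF) =
    Equivalence.from (residueComplete-shift⇔ perG s≤kA)
      (Equivalence.from (residueComplete-scaled⇔ {d = d} {x = F} tail) (d-inv , rcF))
    where
    instance
      kF≢0 : NonZero kF
      kF≢0 = >-nonZero kF>0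
    perG : Periodic G kA
    perG = isPeriodLength⇒periodic isPeriodG
    perF : Periodic F kF
    perF = isPeriodLength⇒periodic isPeriodF
    s≤kA : s ≤ kA
    s≤kA = <⇒≤ (subst (s ℕ.<_) (length-periodList G kA) s<length)
    residues-agree : applyUpTo (λ n → G (n ℕ.+ s) %ℕ m) kA ≡ applyUpTo (λ n → (d * F n) %ℕ m) kF
    residues-agree = ≡.trans (≡.sym (rotate-periodList perG s≤kA)) (≡.trans cyclic (scaleMod-periodList d F kF))
    kA≡kF : kA ≡ kF
    kA≡kF = ≡.trans (≡.sym (length-applyUpTo _ kA)) (≡.trans (cong length residues-agree) (length-applyUpTo _ kF))
    residues-agree′ : applyUpTo (λ n → G (n ℕ.+ s) %ℕ m) kF ≡ applyUpTo (λ n → (d * F n) %ℕ m) kF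
    residues-agree′ = subst (λ k → applyUpTo _ k ≡ _) kA≡kF residues-agree
    tail : ∀ n → G (n ℕ.+ s) ≋ d * F n
    tail = periodic-agree (periodic-shift (subst (Periodic G) kA≡kF perG) s) (periodic-*ˡ {d = d} perF)
             (λ i<kF → %ℕ-injective (applyUpTo-injective kF residues-agree′ i<kF))
    d-inv : Invertible d
    d-inv = Equivalence.from (invertible⇔norm tail) (Equivalence.from invertible⇔gcd≡1 gcd≡1)

lemma2p7 : (a b q : ℤ) → q ≢ 0ℤ → (m : ℕ) → .{{_ : NonZero m}} →
    (kA kF : ℕ) → IsPeriodLength m (w a b q) kA → IsPeriodLength m (w 0ℤ 1ℤ q) kF →
    (ResidueComplete m (w a b q) ⇔
      ((∃ λ (d : ℤ) → CyclicPerm (periodList m (w a b q) kA) (scaleMod m d (periodList m (w 0ℤ 1ℤ q) kF)))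
       × (gcd (a * a + q * a * b - b * b) (+ m) ≡ 1ℤ)
       × ResidueComplete m (w 0ℤ 1ℤ q)))
    × (ResidueComplete m (w a b q) → (r : ℕ) → 0 ℕ.< r → r ∣ℕ m → ResidueComplete r (w a b q))
lemma2p7 a b q _ m _ _ isPeriodG isPeriodF =
  mk⇔ (residueComplete⇒conditions isPeriodG isPeriodF) (conditions⇒residueComplete isPeriodG isPeriodF) ,
  λ rc _ _ r∣m → residueComplete-∣ {x = w a b q} r∣m rc
  where open Criterion a b q m
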